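{- Let $D$ be a $\langle 2,2\rangle$ digraph and $G=CCE(D)$. If a vertex $w$ of $D$ has two (distinct) prey $u$ and $v$ that are not adjacent in $G$, then each of $u$ and $v$ has degree at most $1$ in $G$.
   Context: All graphs and digraphs are simple (no loops, no multiple arcs). In a digraph $D$, if $(u,x)$ is an arc then $x$ is a prey of $u$ and $u$ is a predator of $x$. The CCE graph $CCE(D)$ of $D$ is the graph on $V(D)$ in which distinct $u,v$ are adjacent iff they have a common prey and a common predator in $D$. A $\langle 2,2\rangle$ digraph is a digraph in which every vertex has indegree at most $2$ and outdegree at most $2$. -}

module Defs where

open import Data.Nat using (ℕ; _≤_)
open import Data.Bool using (Bool; true; false; _∧_; not)
open import Data.Fin using (Fin; _≟_)
open import Data.List using (List; length; filter; allFin)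
open import Data.Bool.ListAction using (any)
open import Data.Product using (_×_)
open import Relation.Nullary.Decidable using (⌊_⌋)
open import Relation.Binary.PropositionalEquality using (_≡_)
open import Relation.Nullary using (¬_)

-- A simple digraph on vertex set Fin n, given by its arc relation
-- (arc u x ≡ true means (u,x) is an arc); no loops. Simplicity (no multiple arcs)
-- is automatic in this representation.
record Digraph (n : ℕ) : Set where
  field
    arc     : Fin n → Fin n → Bool
    loopless : ∀ u → arc u u ≡ false
open Digraph public

count : ∀ {n} → (Fin n → Bool) → ℕ
count {n} p = length (filter (λ x → Data.Bool._≟_ (p x) true) (allFin n))

outdeg : ∀ {n} → Digraph n → Fin n → ℕ
outdeg D u = count (λ x → arc D u x)

indeg : ∀ {n} → Digraph n → Fin n → ℕ
indeg D x = count (λ u → arc D u x)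

Is22 : ∀ {n} → Digraph n → Set
Is22 D = ∀ v → indeg D v ≤ 2 × outdeg D v ≤ 2

cceAdj : ∀ {n} → Digraph n → Fin n → Fin n → Bool
cceAdj {n} D u v =
  not ⌊ u ≟ v ⌋
  ∧ any (λ x → arc D u x ∧ arc D v x) (allFin n)
  ∧ any (λ y → arc D y u ∧ arc D y v) (allFin n)

cceDeg : ∀ {n} → Digraph n → Fin n → ℕ
cceDeg D u = count (cceAdj D u)

-- If u had two CCE-neighbours a ≠ b, pick common predators y_a of {u,a} and y_b of {u,b}.
-- When y_a = y_b this vertex has the three prey u, a, b. Otherwise w, y_a, y_b are three
-- predators of u: neither y_a nor y_b is w, since a CCE-neighbour c of u is neither u nor v
-- (u and v are not adjacent), so a prey c of w would be a third prey of w beside u and v.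
module Submission where

open import Defs
open import Data.Nat using (ℕ; _≤_; _<_; s≤s; z≤n; _≤?_)
open import Data.Nat.Properties using (≤⇒≯; ≰⇒>)
open import Data.Bool using (Bool; true; false; _∧_; not)
open import Data.Bool.Properties using (∧-comm; T-≡)
open import Data.Fin using (Fin; _≟_)
open import Data.List using (List; []; _∷_; length; filter; allFin)
open import Data.List.Properties using (map-cong)
open import Data.List.Membership.Propositional using (_∈_)
open import Data.List.Membership.Propositional.Properties using (∈-filter⁺; ∈-filter⁻; ∈-allFin)
open import Data.List.Relation.Unary.Any using (here; there; satisfied)
open import Data.List.Relation.Unary.Any.Properties using (any⁻)
open import Data.List.Relation.Unary.AllPairs using (_∷_)
open import Data.List.Relation.Unary.All using (_∷_)
open import Data.List.Relation.Unary.Unique.Propositional using (Unique)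
open import Data.List.Relation.Unary.Unique.Propositional.Properties using (filter⁺; allFin⁺)
open import Data.Bool.ListAction using (any; or)
open import Data.Product using (_×_; _,_; proj₁; proj₂; ∃-syntax)
open import Data.Empty using (⊥; ⊥-elim)
open import Function using (Equivalence)
open import Relation.Binary.PropositionalEquality using (_≡_; _≢_; refl; sym; trans; cong; cong₂; ≢-sym)
open import Relation.Nullary using (¬_; yes; no)
open import Relation.Nullary.Decidable using (⌊_⌋)

module _ {A : Set} where

  ∈⇒length≥1 : ∀ {x : A} {xs} → x ∈ xs → 1 ≤ length xs
  ∈⇒length≥1 (here _)  = s≤s z≤n
  ∈⇒length≥1 (there _) = s≤s z≤n

  ∈⇒length≥2 : ∀ {x y : A} {xs} → x ∈ xs → y ∈ xs → x ≢ y → 2 ≤ length xs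
  ∈⇒length≥2 (here refl) (here refl) x≢y = ⊥-elim (x≢y refl)
  ∈⇒length≥2 (here _)    (there y∈)  _   = s≤s (∈⇒length≥1 y∈)
  ∈⇒length≥2 (there x∈)  _           _   = s≤s (∈⇒length≥1 x∈)

  ∈⇒length≥3 : ∀ {x y z : A} {xs} → x ∈ xs → y ∈ xs → z ∈ xs →
               x ≢ y → x ≢ z → y ≢ z → 3 ≤ length xs
  ∈⇒length≥3 (here refl) (here refl) _           x≢y _   _   = ⊥-elim (x≢y refl)
  ∈⇒length≥3 (here refl) _           (here refl) _   x≢z _   = ⊥-elim (x≢z refl)
  ∈⇒length≥3 _           (here refl) (here refl) _   _   y≢z = ⊥-elim (y≢z refl)
  ∈⇒length≥3 (here _)    (there y∈)  (there z∈)  _   _   y≢z = s≤s (∈⇒length≥2 y∈ z∈ y≢z)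
  ∈⇒length≥3 (there x∈)  (here _)    (there z∈)  _   x≢z _   = s≤s (∈⇒length≥2 x∈ z∈ x≢z)
  ∈⇒length≥3 (there x∈)  (there y∈)  _           x≢y _   _   = s≤s (∈⇒length≥2 x∈ y∈ x≢y)

  unique-length>1⇒distinct-pair : ∀ {xs : List A} → Unique xs → 1 < length xs →
                                  ∃[ x ] ∃[ y ] x ∈ xs × y ∈ xs × x ≢ y
  unique-length>1⇒distinct-pair {x ∷ y ∷ _} ((x≢y ∷ _) ∷ _) _ =
    x , y , here refl , there (here refl) , x≢y
  unique-length>1⇒distinct-pair {_ ∷ []} _ (s≤s ())

module _ {n : ℕ} (p : Fin n → Bool) where

  private
    P? = λ x → Data.Bool._≟_ (p x) true

    true⇒∈counted : ∀ {x} → p x ≡ true → x ∈ filter P? (allFin n)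
    true⇒∈counted {x} px = ∈-filter⁺ P? (∈-allFin x) px

  count≥3 : ∀ {x y z} → p x ≡ true → p y ≡ true → p z ≡ true →
            x ≢ y → x ≢ z → y ≢ z → 3 ≤ count p
  count≥3 px py pz = ∈⇒length≥3 (true⇒∈counted px) (true⇒∈counted py) (true⇒∈counted pz)

  count>1⇒distinct-pair : 1 < count p → ∃[ x ] ∃[ y ] p x ≡ true × p y ≡ true × x ≢ y
  count>1⇒distinct-pair 1<count
    with x , y , x∈ , y∈ , x≢y ← unique-length>1⇒distinct-pair (filter⁺ P? (allFin⁺ n)) 1<count
    = x , y , counted x∈ , counted y∈ , x≢y
    where
    counted : ∀ {z} → z ∈ filter P? (allFin n) → p z ≡ true
    counted z∈ with _ , pz ← ∈-filter⁻ P? {xs = allFin n} z∈ = pz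

any-witness : ∀ {A : Set} (p : A → Bool) xs → any p xs ≡ true → ∃[ x ] p x ≡ true
any-witness p xs e with x , px ← satisfied (any⁻ p xs (Equivalence.from T-≡ e)) =
  x , Equivalence.to T-≡ px

∧-true⇒ : ∀ {a b} → a ∧ b ≡ true → a ≡ true × b ≡ true
∧-true⇒ {true} b≡true = refl , b≡true

not⌊≟⌋-sym : ∀ {n} (u v : Fin n) → not ⌊ u ≟ v ⌋ ≡ not ⌊ v ≟ u ⌋
not⌊≟⌋-sym u v with u ≟ v | v ≟ u
... | yes _   | yes _   = refl
... | no _    | no _    = refl
... | yes u≡v | no v≢u  = ⊥-elim (v≢u (sym u≡v))
... | no u≢v  | yes v≡u = ⊥-elim (u≢v (sym v≡u))

module _ {n : ℕ} (D : Digraph n) where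

  cceAdj-sym : ∀ u v → cceAdj D u v ≡ cceAdj D v u
  cceAdj-sym u v = cong₂ _∧_ (not⌊≟⌋-sym u v) (cong₂ _∧_
    (cong or (map-cong (λ x → ∧-comm (arc D u x) (arc D v x)) (allFin n)))
    (cong or (map-cong (λ y → ∧-comm (arc D y u) (arc D y v)) (allFin n))))

  cceAdj⇒≢ : ∀ {u a} → cceAdj D u a ≡ true → u ≢ a
  cceAdj⇒≢ {u} {a} adj with u ≟ a | adj
  ... | no u≢a | _ = u≢a

  cceAdj⇒common-predator : ∀ {u a} → cceAdj D u a ≡ true →
                           ∃[ y ] arc D y u ≡ true × arc D y a ≡ true
  cceAdj⇒common-predator {u} {a} adj
    with _ , common ← ∧-true⇒ {not ⌊ u ≟ a ⌋} adj
    with _ , common-predator ← ∧-true⇒ {any (λ x → arc D u x ∧ arc D a x) (allFin n)} common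
    with y , y→u∧a ← any-witness _ (allFin n) common-predator
    = y , ∧-true⇒ y→u∧a

  module _ (D22 : Is22 D) where

    no-three-prey : ∀ {y a b c} → arc D y a ≡ true → arc D y b ≡ true → arc D y c ≡ true →
                    a ≢ b → a ≢ c → b ≢ c → ⊥
    no-three-prey {y} ya yb yc a≢b a≢c b≢c =
      ≤⇒≯ (proj₂ (D22 y)) (count≥3 (arc D y) ya yb yc a≢b a≢c b≢c)

    no-three-predators : ∀ {x a b c} → arc D a x ≡ true → arc D b x ≡ true → arc D c x ≡ true →
                         a ≢ b → a ≢ c → b ≢ c → ⊥
    no-three-predators {x} ax bx cx a≢b a≢c b≢c =
      ≤⇒≯ (proj₁ (D22 x)) (count≥3 (λ y → arc D y x) ax bx cx a≢b a≢c b≢c)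

    module _ {w u v : Fin n} (u≢v : u ≢ v) (wu : arc D w u ≡ true) (wv : arc D w v ≡ true)
             (u≁v : cceAdj D u v ≡ false) where

      common-predator≢w : ∀ {c y} → cceAdj D u c ≡ true →
                                arc D y u ≡ true → arc D y c ≡ true → y ≢ w
      common-predator≢w {c} u∼c _ yc refl with c ≟ v
      ... | yes refl with () ← trans (sym u≁v) u∼c
      ... | no c≢v = no-three-prey wu wv yc u≢v (cceAdj⇒≢ u∼c) (≢-sym c≢v)

      cceDeg≤1 : cceDeg D u ≤ 1
      cceDeg≤1 with cceDeg D u ≤? 1
      ... | yes deg≤1 = deg≤1
      ... | no deg≰1
        with a , b , u∼a , u∼b , a≢b ← count>1⇒distinct-pair (cceAdj D u) (≰⇒> deg≰1)
        with ya , ya→u , ya→a ← cceAdj⇒common-predator u∼a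
        with yb , yb→u , yb→b ← cceAdj⇒common-predator u∼b
        with ya ≟ yb
      ... | yes refl = ⊥-elim (no-three-prey ya→u ya→a yb→b (cceAdj⇒≢ u∼a) (cceAdj⇒≢ u∼b) a≢b)
      ... | no ya≢yb = ⊥-elim (no-three-predators wu ya→u yb→u
              (≢-sym (common-predator≢w u∼a ya→u ya→a))
              (≢-sym (common-predator≢w u∼b yb→u yb→b)) ya≢yb)

proposition2p3 : ∀ {n} (D : Digraph n) → Is22 D → (w u v : Fin n) →
                   ¬ (u ≡ v) → arc D w u ≡ true → arc D w v ≡ true →
                   cceAdj D u v ≡ false →
                   cceDeg D u ≤ 1 × cceDeg D v ≤ 1
proposition2p3 D D22 w u v u≢v wu wv u≁v =
  cceDeg≤1 D D22 u≢v wu wv u≁v ,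
  cceDeg≤1 D D22 (≢-sym u≢v) wv wu (trans (cceAdj-sym D v u) u≁v)
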